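{- Let $(T,\eta,\mu)$ be a monad on a category $\mathcal{C}$, with Eilenberg-Moore adjunction $\mathcal{F}\dashv U\colon\mathcal{EM}(T)\to\mathcal{C}$. Let $B$ be an endofunctor on $\mathcal{C}$ having a final coalgebra, let $\kappa\colon TB\Rightarrow BT$ be an Eilenberg-Moore law, with corresponding lifting $\overline{B}$ of $B$ to $\mathcal{EM}(T)$, and let $A$ be an endofunctor on $\mathcal{C}$. Then there are bijective correspondences between: (i) natural transformations $\rho\colon AU\Rightarrow U\overline{B}$ (of functors $\mathcal{EM}(T)\to\mathcal{C}$); (ii) natural transformations $\mathfrak{e}\colon TA\Rightarrow BT$ satisfying $\mathfrak{e}\circ\mu A = B\mu\circ\kappa T\circ T\mathfrak{e}$ (as natural transformations $T^2A\Rightarrow BT$); (iii) natural transformations $A\Rightarrow BT$.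
   Context: An Eilenberg-Moore law is a natural transformation $\kappa\colon TB\Rightarrow BT$ with $\kappa\circ\eta B=B\eta$ and $\kappa\circ\mu B=B\mu\circ\kappa T\circ T\kappa$. The corresponding lifting $\overline{B}\colon\mathcal{EM}(T)\to\mathcal{EM}(T)$ sends an algebra $(X,a)$ to $(B(X),B(a)\circ\kappa_X)$ and acts as $B$ on morphisms, so that $U\overline{B}=BU$. $\mathcal{F}(X)=(T(X),\mu_X)$ and $U$ is the forgetful functor. -}

module Defs where

open import Level using (Level; _⊔_; suc)
open import Relation.Binary using (Rel; IsEquivalence; Setoid)
open import Data.Product using (Σ; _,_; proj₁; proj₂)
import Relation.Binary.Reasoning.Setoid as SetoidR

record Category (o ℓ e : Level) : Set (suc (o ⊔ ℓ ⊔ e)) where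
  infixr 9 _∘_
  infix  4 _≈_
  infix  4 _⇒_
  field
    Obj  : Set o
    _⇒_  : Obj → Obj → Set ℓ
    _≈_  : ∀ {A B} → Rel (A ⇒ B) e
    id   : ∀ {A} → A ⇒ A
    _∘_  : ∀ {A B C} → B ⇒ C → A ⇒ B → A ⇒ C
    equiv     : ∀ {A B} → IsEquivalence (_≈_ {A} {B})
    assoc     : ∀ {A B C D} {f : A ⇒ B} {g : B ⇒ C} {h : C ⇒ D} →
                (h ∘ g) ∘ f ≈ h ∘ (g ∘ f)
    identityˡ : ∀ {A B} {f : A ⇒ B} → id ∘ f ≈ f
    identityʳ : ∀ {A B} {f : A ⇒ B} → f ∘ id ≈ f
    ∘-resp-≈  : ∀ {A B C} {f h : B ⇒ C} {g i : A ⇒ B} →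
                f ≈ h → g ≈ i → f ∘ g ≈ h ∘ i

  hom-setoid : Obj → Obj → Setoid ℓ e
  hom-setoid A B = record { Carrier = A ⇒ B ; _≈_ = _≈_ ; isEquivalence = equiv }

  module Equiv {A B : Obj} = IsEquivalence (equiv {A} {B})

  sym-assoc : ∀ {A B C D} {f : A ⇒ B} {g : B ⇒ C} {h : C ⇒ D} →
              h ∘ (g ∘ f) ≈ (h ∘ g) ∘ f
  sym-assoc = Equiv.sym assoc

  refl⟩∘⟨_ : ∀ {A B C} {f : B ⇒ C} {g i : A ⇒ B} → g ≈ i → f ∘ g ≈ f ∘ i
  refl⟩∘⟨ p = ∘-resp-≈ Equiv.refl p

  _⟩∘⟨refl : ∀ {A B C} {f h : B ⇒ C} {g : A ⇒ B} → f ≈ h → f ∘ g ≈ h ∘ g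
  p ⟩∘⟨refl = ∘-resp-≈ p Equiv.refl

record Functor {o ℓ e o′ ℓ′ e′ : Level}
               (C : Category o ℓ e) (D : Category o′ ℓ′ e′)
               : Set (o ⊔ ℓ ⊔ e ⊔ o′ ⊔ ℓ′ ⊔ e′) where
  private
    module C = Category C
    module D = Category D
  field
    F₀ : C.Obj → D.Obj
    F₁ : ∀ {A B} → A C.⇒ B → F₀ A D.⇒ F₀ B
    identity     : ∀ {A} → F₁ (C.id {A}) D.≈ D.id
    homomorphism : ∀ {X Y Z} {f : X C.⇒ Y} {g : Y C.⇒ Z} →
                   F₁ (g C.∘ f) D.≈ F₁ g D.∘ F₁ f
    F-resp-≈     : ∀ {A B} {f g : A C.⇒ B} → f C.≈ g → F₁ f D.≈ F₁ g

idF : ∀ {o ℓ e} {C : Category o ℓ e} → Functor C C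
idF {C = C} = record
  { F₀ = λ X → X ; F₁ = λ f → f
  ; identity = Equiv.refl ; homomorphism = Equiv.refl ; F-resp-≈ = λ p → p }
  where open Category C

infixr 9 _∘F_
_∘F_ : ∀ {o ℓ e o′ ℓ′ e′ o″ ℓ″ e″}
         {C : Category o ℓ e} {D : Category o′ ℓ′ e′} {E : Category o″ ℓ″ e″} →
       Functor D E → Functor C D → Functor C E
_∘F_ {E = E} G F = record
  { F₀ = λ X → G.F₀ (F.F₀ X)
  ; F₁ = λ f → G.F₁ (F.F₁ f)
  ; identity = Equiv.trans (G.F-resp-≈ F.identity) G.identity
  ; homomorphism = Equiv.trans (G.F-resp-≈ F.homomorphism) G.homomorphism
  ; F-resp-≈ = λ p → G.F-resp-≈ (F.F-resp-≈ p)
  }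
  where
    module G = Functor G
    module F = Functor F
    open Category E

record NatTrans {o ℓ e o′ ℓ′ e′ : Level}
                {C : Category o ℓ e} {D : Category o′ ℓ′ e′}
                (F G : Functor C D) : Set (o ⊔ ℓ ⊔ ℓ′ ⊔ e′) where
  private
    module C = Category C
    module D = Category D
    module F = Functor F
    module G = Functor G
  field
    η       : ∀ X → F.F₀ X D.⇒ G.F₀ X
    commute : ∀ {X Y} (f : X C.⇒ Y) → η Y D.∘ F.F₁ f D.≈ G.F₁ f D.∘ η X

NatTrans-setoid : ∀ {o ℓ e o′ ℓ′ e′}
                    {C : Category o ℓ e} {D : Category o′ ℓ′ e′}
                  (F G : Functor C D) → Setoid (o ⊔ ℓ ⊔ ℓ′ ⊔ e′) (o ⊔ e′)
NatTrans-setoid {D = D} F G = record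
  { Carrier = NatTrans F G
  ; _≈_ = λ α β → ∀ X → NatTrans.η α X D.≈ NatTrans.η β X
  ; isEquivalence = record
    { refl = λ X → D.Equiv.refl
    ; sym = λ p X → D.Equiv.sym (p X)
    ; trans = λ p q X → D.Equiv.trans (p X) (q X) }
  }
  where module D = Category D

record Monad {o ℓ e : Level} (C : Category o ℓ e) : Set (o ⊔ ℓ ⊔ e) where
  open Category C
  field
    T : Functor C C
    η : NatTrans idF T
    μ : NatTrans (T ∘F T) T
  open Functor T public using (F₀; F₁)
  ηₓ : ∀ X → X ⇒ F₀ X
  ηₓ = NatTrans.η η
  μₓ : ∀ X → F₀ (F₀ X) ⇒ F₀ X
  μₓ = NatTrans.η μ
  field
    identityˡ : ∀ {X} → μₓ X ∘ F₁ (ηₓ X) ≈ id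
    identityʳ : ∀ {X} → μₓ X ∘ ηₓ (F₀ X) ≈ id
    assoc     : ∀ {X} → μₓ X ∘ F₁ (μₓ X) ≈ μₓ X ∘ μₓ (F₀ X)

module EM {o ℓ e : Level} {C : Category o ℓ e} (M : Monad C) where
  open Category C
  open Monad M using (T; F₀; F₁; ηₓ; μₓ)
  module T = Functor T

  record Algebra : Set (o ⊔ ℓ ⊔ e) where
    field
      carrier : Obj
      act     : F₀ carrier ⇒ carrier
      unit    : act ∘ ηₓ carrier ≈ id
      mult    : act ∘ F₁ act ≈ act ∘ μₓ carrier

  record AlgHom (X Y : Algebra) : Set (ℓ ⊔ e) where
    private
      module X = Algebra X
      module Y = Algebra Y
    field
      hom     : X.carrier ⇒ Y.carrier
      commute : hom ∘ X.act ≈ Y.act ∘ F₁ hom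

  open Algebra
  open AlgHom

  EM-id : ∀ {X} → AlgHom X X
  EM-id {X} = record
    { hom = id
    ; commute = Equiv.trans identityˡ
                  (Equiv.trans (Equiv.sym identityʳ) (refl⟩∘⟨ Equiv.sym T.identity)) }

  EM-∘ : ∀ {X Y Z} → AlgHom Y Z → AlgHom X Y → AlgHom X Z
  EM-∘ {X} {Y} {Z} g f = record
    { hom = hom g ∘ hom f
    ; commute = begin
        (hom g ∘ hom f) ∘ act X        ≈⟨ assoc ⟩
        hom g ∘ (hom f ∘ act X)        ≈⟨ refl⟩∘⟨ commute f ⟩
        hom g ∘ (act Y ∘ F₁ (hom f))   ≈⟨ sym-assoc ⟩
        (hom g ∘ act Y) ∘ F₁ (hom f)   ≈⟨ commute g ⟩∘⟨refl ⟩
        (act Z ∘ F₁ (hom g)) ∘ F₁ (hom f) ≈⟨ assoc ⟩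
        act Z ∘ (F₁ (hom g) ∘ F₁ (hom f)) ≈⟨ refl⟩∘⟨ Equiv.sym T.homomorphism ⟩
        act Z ∘ F₁ (hom g ∘ hom f)     ∎ }
    where open SetoidR (hom-setoid _ _)

  EMCat : Category (o ⊔ ℓ ⊔ e) (ℓ ⊔ e) e
  EMCat = record
    { Obj = Algebra
    ; _⇒_ = AlgHom
    ; _≈_ = λ f g → hom f ≈ hom g
    ; id = EM-id
    ; _∘_ = EM-∘
    ; equiv = record { refl = Equiv.refl ; sym = Equiv.sym ; trans = Equiv.trans }
    ; assoc = assoc
    ; identityˡ = identityˡ
    ; identityʳ = identityʳ
    ; ∘-resp-≈ = ∘-resp-≈
    }

  U : Functor EMCat C
  U = record
    { F₀ = carrier ; F₁ = hom
    ; identity = Equiv.refl ; homomorphism = Equiv.refl ; F-resp-≈ = λ p → p }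

record EMLaw {o ℓ e : Level} {C : Category o ℓ e}
             (M : Monad C) (B : Functor C C) : Set (o ⊔ ℓ ⊔ e) where
  open Category C
  open Monad M using (T; F₀; F₁; ηₓ; μₓ)
  module B = Functor B
  field
    κ : NatTrans (T ∘F B) (B ∘F T)
  κₓ : ∀ X → F₀ (B.F₀ X) ⇒ B.F₀ (F₀ X)
  κₓ = NatTrans.η κ
  field
    κ-unit : ∀ {X} → κₓ X ∘ ηₓ (B.F₀ X) ≈ B.F₁ (ηₓ X)
    κ-mult : ∀ {X} → κₓ X ∘ μₓ (B.F₀ X) ≈ B.F₁ (μₓ X) ∘ (κₓ (F₀ X) ∘ F₁ (κₓ X))

module Lifting {o ℓ e : Level} {C : Category o ℓ e}
               (M : Monad C) (B : Functor C C) (L : EMLaw M B) where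
  open Category C
  open Monad M using (T; F₀; F₁; ηₓ; μₓ)
  module B = Functor B
  open EMLaw L using (κ; κₓ; κ-unit; κ-mult)
  open EM M
  open Algebra
  open AlgHom
  private
    module Rsn {A B : Obj} = SetoidR (hom-setoid A B)
    κc = NatTrans.commute κ

  liftAlg : Algebra → Algebra
  liftAlg X = record
    { carrier = B.F₀ (carrier X)
    ; act = B.F₁ (act X) ∘ κₓ (carrier X)
    ; unit = begin
        (B.F₁ (act X) ∘ κₓ x) ∘ ηₓ (B.F₀ x)   ≈⟨ assoc ⟩
        B.F₁ (act X) ∘ (κₓ x ∘ ηₓ (B.F₀ x))   ≈⟨ refl⟩∘⟨ κ-unit ⟩
        B.F₁ (act X) ∘ B.F₁ (ηₓ x)            ≈⟨ Equiv.sym B.homomorphism ⟩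
        B.F₁ (act X ∘ ηₓ x)                    ≈⟨ B.F-resp-≈ (unit X) ⟩
        B.F₁ id                                 ≈⟨ B.identity ⟩
        id ∎
    ; mult = begin
        (B.F₁ (act X) ∘ κₓ x) ∘ F₁ (B.F₁ (act X) ∘ κₓ x)
          ≈⟨ refl⟩∘⟨ T.homomorphism ⟩
        (B.F₁ (act X) ∘ κₓ x) ∘ (F₁ (B.F₁ (act X)) ∘ F₁ (κₓ x))
          ≈⟨ assoc ⟩
        B.F₁ (act X) ∘ (κₓ x ∘ (F₁ (B.F₁ (act X)) ∘ F₁ (κₓ x)))
          ≈⟨ refl⟩∘⟨ sym-assoc ⟩
        B.F₁ (act X) ∘ ((κₓ x ∘ F₁ (B.F₁ (act X))) ∘ F₁ (κₓ x))
          ≈⟨ refl⟩∘⟨ (κc (act X) ⟩∘⟨refl) ⟩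
        B.F₁ (act X) ∘ ((B.F₁ (F₁ (act X)) ∘ κₓ (F₀ x)) ∘ F₁ (κₓ x))
          ≈⟨ refl⟩∘⟨ assoc ⟩
        B.F₁ (act X) ∘ (B.F₁ (F₁ (act X)) ∘ (κₓ (F₀ x) ∘ F₁ (κₓ x)))
          ≈⟨ sym-assoc ⟩
        (B.F₁ (act X) ∘ B.F₁ (F₁ (act X))) ∘ (κₓ (F₀ x) ∘ F₁ (κₓ x))
          ≈⟨ Equiv.sym B.homomorphism ⟩∘⟨refl ⟩
        B.F₁ (act X ∘ F₁ (act X)) ∘ (κₓ (F₀ x) ∘ F₁ (κₓ x))
          ≈⟨ B.F-resp-≈ (mult X) ⟩∘⟨refl ⟩
        B.F₁ (act X ∘ μₓ x) ∘ (κₓ (F₀ x) ∘ F₁ (κₓ x))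
          ≈⟨ B.homomorphism ⟩∘⟨refl ⟩
        (B.F₁ (act X) ∘ B.F₁ (μₓ x)) ∘ (κₓ (F₀ x) ∘ F₁ (κₓ x))
          ≈⟨ assoc ⟩
        B.F₁ (act X) ∘ (B.F₁ (μₓ x) ∘ (κₓ (F₀ x) ∘ F₁ (κₓ x)))
          ≈⟨ refl⟩∘⟨ Equiv.sym κ-mult ⟩
        B.F₁ (act X) ∘ (κₓ x ∘ μₓ (B.F₀ x))
          ≈⟨ sym-assoc ⟩
        (B.F₁ (act X) ∘ κₓ x) ∘ μₓ (B.F₀ x) ∎
    }
    where
      x = carrier X
      open Rsn

  liftHom : ∀ {X Y} → AlgHom X Y → AlgHom (liftAlg X) (liftAlg Y)
  liftHom {X} {Y} f = record
    { hom = B.F₁ (hom f)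
    ; commute = begin
        B.F₁ (hom f) ∘ (B.F₁ (act X) ∘ κₓ (carrier X))   ≈⟨ sym-assoc ⟩
        (B.F₁ (hom f) ∘ B.F₁ (act X)) ∘ κₓ (carrier X)   ≈⟨ Equiv.sym B.homomorphism ⟩∘⟨refl ⟩
        B.F₁ (hom f ∘ act X) ∘ κₓ (carrier X)            ≈⟨ B.F-resp-≈ (commute f) ⟩∘⟨refl ⟩
        B.F₁ (act Y ∘ F₁ (hom f)) ∘ κₓ (carrier X)       ≈⟨ B.homomorphism ⟩∘⟨refl ⟩
        (B.F₁ (act Y) ∘ B.F₁ (F₁ (hom f))) ∘ κₓ (carrier X) ≈⟨ assoc ⟩
        B.F₁ (act Y) ∘ (B.F₁ (F₁ (hom f)) ∘ κₓ (carrier X)) ≈⟨ refl⟩∘⟨ Equiv.sym (κc (hom f)) ⟩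
        B.F₁ (act Y) ∘ (κₓ (carrier Y) ∘ F₁ (B.F₁ (hom f))) ≈⟨ sym-assoc ⟩
        (B.F₁ (act Y) ∘ κₓ (carrier Y)) ∘ F₁ (B.F₁ (hom f)) ∎ }
    where open Rsn

  B̄ : Functor EMCat EMCat
  B̄ = record
    { F₀ = liftAlg
    ; F₁ = liftHom
    ; identity = B.identity
    ; homomorphism = B.homomorphism
    ; F-resp-≈ = B.F-resp-≈
    }

record Coalgebra {o ℓ e : Level} {C : Category o ℓ e} (B : Functor C C)
                 : Set (o ⊔ ℓ) where
  open Category C
  field
    carrier : Category.Obj C
    coact   : carrier ⇒ Functor.F₀ B carrier

record CoalgHom {o ℓ e : Level} {C : Category o ℓ e} {B : Functor C C}
                (X Y : Coalgebra B) : Set (ℓ ⊔ e) where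
  open Category C
  private
    module X = Coalgebra X
    module Y = Coalgebra Y
  field
    hom     : X.carrier ⇒ Y.carrier
    commute : Y.coact ∘ hom ≈ Functor.F₁ B hom ∘ X.coact

record FinalCoalgebra {o ℓ e : Level} {C : Category o ℓ e} (B : Functor C C)
                      : Set (o ⊔ ℓ ⊔ e) where
  open Category C
  field
    Z      : Coalgebra B
    !      : (X : Coalgebra B) → CoalgHom X Z
    !-uniq : (X : Coalgebra B) (h : CoalgHom X Z) →
             CoalgHom.hom h ≈ CoalgHom.hom (! X)

module _ {o ℓ e : Level} {C : Category o ℓ e}
         (M : Monad C) (B : Functor C C) (L : EMLaw M B) (A : Functor C C) where
  open Category C
  open Monad M using (T; F₀; F₁; ηₓ; μₓ)
  open EMLaw L using (κₓ)

  Compatible : NatTrans (T ∘F A) (B ∘F T) → Set (o ⊔ e)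
  Compatible 𝔢 = ∀ X →
    NatTrans.η 𝔢 X ∘ μₓ (Functor.F₀ A X)
      ≈ Functor.F₁ B (μₓ X) ∘ (κₓ (F₀ X) ∘ F₁ (NatTrans.η 𝔢 X))

  Compatible-setoid : Setoid (o ⊔ ℓ ⊔ e) (o ⊔ e)
  Compatible-setoid = record
    { Carrier = Σ (NatTrans (T ∘F A) (B ∘F T)) Compatible
    ; _≈_ = λ p q → Setoid._≈_ (NatTrans-setoid (T ∘F A) (B ∘F T)) (proj₁ p) (proj₁ q)
    ; isEquivalence = record
      { refl = λ X → Equiv.refl
      ; sym = λ p X → Equiv.sym (p X)
      ; trans = λ p q X → Equiv.trans (p X) (q X) }
    }

-- Both correspondences come from the free algebra adjunction F ⊣ U.
-- Whiskering with U is left adjoint to whiskering with F, so transformations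
-- AU ⇒ UB̄ are transposed to A ⇒ UB̄F, and UB̄F = BT on the nose.
-- Condition (ii) says exactly that every component 𝔢_X is an algebra map from
-- the free algebra (TAX, μ) to B̄F X = (BTX, Bμ ∘ κT); such maps are determined
-- by their restriction along η, and every map AX ⇒ BTX extends to one.
module Submission where

open import Defs
open import Level using (Level)
open import Data.Product using (_×_; _,_; proj₁)
open import Function.Bundles using (Inverse)
open import Function.Construct.Composition using (inverse)
open import Relation.Binary using (Setoid)
import Function.Consequences.Setoid as Consequences
import Relation.Binary.Reasoning.Setoid as SetoidR

mk-inverse : ∀ {a ℓ₁ b ℓ₂} {S : Setoid a ℓ₁} {T : Setoid b ℓ₂} →
  let open Setoid S using () renaming (Carrier to A; _≈_ to _≈₁_)
      open Setoid T using () renaming (Carrier to B; _≈_ to _≈₂_) in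
  (to : A → B) (from : B → A) →
  (∀ {x y} → x ≈₁ y → to x ≈₂ to y) → (∀ {x y} → x ≈₂ y → from x ≈₁ from y) →
  (∀ y → to (from y) ≈₂ y) → (∀ x → from (to x) ≈₁ x) → Inverse S T
mk-inverse {S = S} {T} to from to-cong from-cong to∘from from∘to = record
  { to = to
  ; from = from
  ; to-cong = to-cong
  ; from-cong = from-cong
  ; inverse = strictlyInverseˡ⇒inverseˡ to-cong to∘from
            , strictlyInverseʳ⇒inverseʳ from-cong from∘to
  }
  where open Consequences S T

module HomReasoning {o ℓ e : Level} (C : Category o ℓ e) where
  open Category C public
  module HomSetoidReasoning {X Y : Obj} = SetoidR (hom-setoid X Y)
  open HomSetoidReasoning public
  open Equiv public using (sym; trans)

  private
    variable
      W X Y Z : Obj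

  pullʳ : {f : X ⇒ Y} {g : Y ⇒ Z} {h : X ⇒ Z} {k : Z ⇒ W} →
          g ∘ f ≈ h → (k ∘ g) ∘ f ≈ k ∘ h
  pullʳ p = trans assoc (refl⟩∘⟨ p)

  pullˡ : {f : Y ⇒ Z} {g : Z ⇒ W} {h : Y ⇒ W} {k : X ⇒ Y} →
          g ∘ f ≈ h → g ∘ (f ∘ k) ≈ h ∘ k
  pullˡ p = trans sym-assoc (p ⟩∘⟨refl)

  cancelʳ : {f : Y ⇒ X} {g : X ⇒ Y} {h : Y ⇒ Z} →
            g ∘ f ≈ id → (h ∘ g) ∘ f ≈ h
  cancelʳ p = trans (pullʳ p) identityʳ

  cancelˡ : {f : X ⇒ Y} {g : Y ⇒ X} {h : Z ⇒ X} →
            g ∘ f ≈ id → g ∘ (f ∘ h) ≈ h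
  cancelˡ p = trans (pullˡ p) identityˡ

  glue : {a₁ : X ⇒ Y} {a₂ : Z ⇒ W} {l : X ⇒ Z} {m : Y ⇒ W}
         {U V : Obj} {b₁ : Y ⇒ U} {b₂ : W ⇒ V} {n : U ⇒ V} →
         b₂ ∘ m ≈ n ∘ b₁ → a₂ ∘ l ≈ m ∘ a₁ → (b₂ ∘ a₂) ∘ l ≈ n ∘ (b₁ ∘ a₁)
  glue sq₁ sq₂ = trans (pullʳ sq₂) (trans (pullˡ sq₁) assoc)

module FunctorProperties {o ℓ e o′ ℓ′ e′ : Level}
    {C : Category o ℓ e} {D : Category o′ ℓ′ e′} (F : Functor C D) where
  private
    module C = Category C
    module D = HomReasoning D
  open Functor F public

  resp-∘ : ∀ {X Y Z} {f : X C.⇒ Y} {g : Y C.⇒ Z} {h : X C.⇒ Z} →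
           g C.∘ f C.≈ h → F₁ g D.∘ F₁ f D.≈ F₁ h
  resp-∘ p = D.trans (D.sym homomorphism) (F-resp-≈ p)

  resp-id : ∀ {X Y} {f : X C.⇒ Y} {g : Y C.⇒ X} →
            g C.∘ f C.≈ C.id → F₁ g D.∘ F₁ f D.≈ D.id
  resp-id p = D.trans (resp-∘ p) identity

  resp-square : ∀ {X Y Y′ Z} {f : X C.⇒ Y} {g : Y C.⇒ Z} {h : X C.⇒ Y′} {k : Y′ C.⇒ Z} →
                g C.∘ f C.≈ k C.∘ h → F₁ g D.∘ F₁ f D.≈ F₁ k D.∘ F₁ h
  resp-square p = D.trans (D.sym homomorphism) (D.trans (F-resp-≈ p) homomorphism)

module FreeAlgebra {o ℓ e : Level} {C : Category o ℓ e} (M : Monad C) where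
  open HomReasoning C
  open Monad M public using (T; ηₓ; μₓ)
  open EM M public using (EMCat; U; Algebra; AlgHom)
  open EM M using (EM-∘)
  open Algebra
  open AlgHom
  module T = FunctorProperties T

  η-natural : ∀ {X Y} (f : X ⇒ Y) → ηₓ Y ∘ f ≈ T.F₁ f ∘ ηₓ X
  η-natural = NatTrans.commute (Monad.η M)

  Free : Functor C EMCat
  Free = record
    { F₀ = λ X → record
      { carrier = T.F₀ X ; act = μₓ X ; unit = Monad.identityʳ M ; mult = Monad.assoc M }
    ; F₁ = λ f → record { hom = T.F₁ f ; commute = sym (NatTrans.commute (Monad.μ M) f) }
    ; identity = T.identity
    ; homomorphism = T.homomorphism
    ; F-resp-≈ = T.F-resp-≈
    }

  module Free = Functor Free

  counit : (X : Algebra) → AlgHom (Free.F₀ (carrier X)) X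
  counit X = record { hom = act X ; commute = sym (mult X) }

  extension : (Y : Algebra) {X : Obj} → X ⇒ carrier Y → AlgHom (Free.F₀ X) Y
  extension Y f = EM-∘ (counit Y) (Free.F₁ f)

  extension-unit : (Y : Algebra) {X : Obj} (f : X ⇒ carrier Y) →
                   hom (extension Y f) ∘ ηₓ X ≈ f
  extension-unit Y f = trans (pullʳ (sym (η-natural f))) (cancelˡ (unit Y))

  extension-unique : {X : Obj} {Y : Algebra} (g : AlgHom (Free.F₀ X) Y) →
                     hom (extension Y (hom g ∘ ηₓ X)) ≈ hom g
  extension-unique {X} {Y} g = begin
    act Y ∘ T.F₁ (hom g ∘ ηₓ X)          ≈⟨ refl⟩∘⟨ T.homomorphism ⟩
    act Y ∘ (T.F₁ (hom g) ∘ T.F₁ (ηₓ X)) ≈⟨ pullˡ (sym (commute g)) ⟩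
    (hom g ∘ μₓ X) ∘ T.F₁ (ηₓ X)          ≈⟨ cancelʳ (Monad.identityˡ M) ⟩
    hom g                                ∎

module Transposition {o ℓ e o′ ℓ′ e′ : Level}
    {C : Category o ℓ e} {D : Category o′ ℓ′ e′}
    (M : Monad C) (A : Functor C D) (G : Functor (EM.EMCat M) D) where
  open HomReasoning D
  open FreeAlgebra M using (U; Algebra; AlgHom; Free; module Free; counit; ηₓ; η-natural)
  open Algebra
  private
    module C = Category C
    module A = FunctorProperties A
    module G = FunctorProperties G

  transpose : NatTrans (A ∘F U) G → NatTrans A (G ∘F Free)
  transpose ρ = record
    { η = λ X → ρ.η (Free.F₀ X) ∘ A.F₁ (ηₓ X)
    ; commute = λ f → glue (ρ.commute (Free.F₁ f)) (A.resp-square (η-natural f))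
    }
    where module ρ = NatTrans ρ

  untranspose : NatTrans A (G ∘F Free) → NatTrans (A ∘F U) G
  untranspose α = record
    { η = λ X → G.F₁ (counit X) ∘ α.η (carrier X)
    ; commute = λ f → glue (G.resp-square (C.Equiv.sym (AlgHom.commute f))) (α.commute (AlgHom.hom f))
    }
    where module α = NatTrans α

  transpose-untranspose : ∀ α X →
    NatTrans.η (transpose (untranspose α)) X ≈ NatTrans.η α X
  transpose-untranspose α X =
    trans (pullʳ (NatTrans.commute α (ηₓ X))) (cancelˡ (G.resp-id (Monad.identityˡ M)))

  untranspose-transpose : ∀ ρ X →
    NatTrans.η (untranspose (transpose ρ)) X ≈ NatTrans.η ρ X
  untranspose-transpose ρ X =
    trans (pullˡ (sym (NatTrans.commute ρ (counit X)))) (cancelʳ (A.resp-id (unit X)))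

  transpose-inverse : Inverse (NatTrans-setoid (A ∘F U) G) (NatTrans-setoid A (G ∘F Free))
  transpose-inverse = mk-inverse transpose untranspose
    (λ p X → p (Free.F₀ X) ⟩∘⟨refl)
    (λ p X → refl⟩∘⟨ p (carrier X))
    transpose-untranspose
    untranspose-transpose

module LiftedFreeAlgebra {o ℓ e : Level} {C : Category o ℓ e}
    (M : Monad C) (B : Functor C C) (L : EMLaw M B) where
  open HomReasoning C
  open FreeAlgebra M
  open Algebra
  open AlgHom
  open Lifting M B L using (B̄)

  B̄Free : Functor C EMCat
  B̄Free = B̄ ∘F Free

  module B̄Free = Functor B̄Free

  U∘B̄Free↔B∘T : (A : Functor C C) →
    Inverse (NatTrans-setoid A ((U ∘F B̄) ∘F Free)) (NatTrans-setoid A (B ∘F T))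
  U∘B̄Free↔B∘T A = mk-inverse
    (λ α → record { η = NatTrans.η α ; commute = NatTrans.commute α })
    (λ α → record { η = NatTrans.η α ; commute = NatTrans.commute α })
    (λ p → p) (λ p → p) (λ _ _ → Equiv.refl) (λ _ _ → Equiv.refl)

  module _ (A : Functor C C) where
    private
      module A = Functor A

    extend : NatTrans A (B ∘F T) → NatTrans (T ∘F A) (B ∘F T)
    extend α = record
      { η = λ X → hom (extension (B̄Free.F₀ X) (α.η X))
      ; commute = λ f → glue (sym (commute (B̄Free.F₁ f))) (T.resp-square (α.commute f))
      }
      where module α = NatTrans α

    extend-compatible : (α : NatTrans A (B ∘F T)) → Compatible M B L A (extend α)
    extend-compatible α X = trans (commute (extension (B̄Free.F₀ X) (NatTrans.η α X))) assoc

    restrict : NatTrans (T ∘F A) (B ∘F T) → NatTrans A (B ∘F T)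
    restrict 𝔢 = record
      { η = λ X → 𝔢.η X ∘ ηₓ (A.F₀ X)
      ; commute = λ f → glue (𝔢.commute f) (η-natural (A.F₁ f))
      }
      where module 𝔢 = NatTrans 𝔢

    compatible⇒algebra-hom : (𝔢 : NatTrans (T ∘F A) (B ∘F T)) → Compatible M B L A 𝔢 →
      ∀ X → AlgHom (Free.F₀ (A.F₀ X)) (B̄Free.F₀ X)
    compatible⇒algebra-hom 𝔢 compatible X = record
      { hom = NatTrans.η 𝔢 X
      ; commute = trans (compatible X) sym-assoc
      }

    compatible↔A⇒BT : Inverse (Compatible-setoid M B L A) (NatTrans-setoid A (B ∘F T))
    compatible↔A⇒BT = mk-inverse
      (λ p → restrict (proj₁ p))
      (λ α → extend α , extend-compatible α)
      (λ p X → p X ⟩∘⟨refl)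
      (λ p X → refl⟩∘⟨ T.F-resp-≈ (p X))
      (λ α X → extension-unit (B̄Free.F₀ X) (NatTrans.η α X))
      (λ { (𝔢 , compatible) X → extension-unique (compatible⇒algebra-hom 𝔢 compatible X) })

proposition3p7 : ∀ {o ℓ e : Level} {C : Category o ℓ e}
    (M : Monad C) (B : Functor C C) → FinalCoalgebra B →
    (L : EMLaw M B) (A : Functor C C) →
    Inverse (NatTrans-setoid (A ∘F EM.U M) (EM.U M ∘F Lifting.B̄ M B L))
            (NatTrans-setoid A (B ∘F Monad.T M))
    × Inverse (Compatible-setoid M B L A)
              (NatTrans-setoid A (B ∘F Monad.T M))
proposition3p7 M B _ L A =
    inverse (Transposition.transpose-inverse M A (EM.U M ∘F Lifting.B̄ M B L))
            (U∘B̄Free↔B∘T A)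
  , compatible↔A⇒BT A
  where open LiftedFreeAlgebra M B L
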